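{- Let $q>2$ be a prime power, let $k$ be a positive integer, and let $\sigma$ be a permutation of $\mathbb{P}^1(\mathbb{F}_q)=\mathbb{F}_q\cup\{\infty\}$. Let $\mathcal{A}_{\sigma,k}$ be the set of all representations of $\sigma$ of the form $$\sigma = \mu(x) \circ x^{q-2} \circ (x-a_k) \circ x^{q-2} \circ (x-a_{k-1}) \circ \cdots \circ x^{q-2} \circ (x-a_1)$$ with $a_1,\dots,a_k\in\mathbb{F}_q$ and $\mu(x)\in\mathbb{F}_q(x)$ of degree one (i.e. the set of tuples $(\mu,a_1,\dots,a_k)$ for which this identity of permutations holds), and let $\mathcal{C}_{\sigma,k}$ be the set of all representations of $\sigma$ of the form $$\sigma = \nu(x) \circ (b_1,\infty) \circ (b_2,\infty) \circ \cdots \circ (b_k,\infty)$$ with $b_1,\dots,b_k\in\mathbb{F}_q$ and $\nu(x)\in\mathbb{F}_q(x)$ of degree one (i.e. the set of tuples $(\nu,b_1,\dots,b_k)$ for which this identity holds). Then there exist two mutually inverse bijections $\mathcal{A}_{\sigma,k}\to\mathcal{C}_{\sigma,k}$ and $\mathcal{C}_{\sigma,k}\to\mathcal{A}_{\sigma,k}$. In particular, the finite sets $\mathcal{A}_{\sigma,k}$ and $\mathcal{C}_{\sigma,k}$ have the same cardinality.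
   Context: All maps are regarded as permutations of $\mathbb{P}^1(\mathbb{F}_q)$, and $f\circ g$ means apply $g$ first. A degree-one rational function $(\alpha x+\beta)/(\gamma x+\delta)$ acts on $\mathbb{P}^1(\mathbb{F}_q)$ in the usual way (so e.g. $x^{ -1}$ swaps $0$ and $\infty$, and degree-one polynomials fix $\infty$). The monomial $x^{q-2}$ acts on $\mathbb{F}_q$ by $c\mapsto c^{q-2}$ (so $0\mapsto 0$ and $c\mapsto c^{ -1}$ for $c\neq0$) and fixes $\infty$; $x-a$ fixes $\infty$. The symbol $(b,\infty)$ denotes the transposition of $\mathbb{P}^1(\mathbb{F}_q)$ swapping $b$ and $\infty$. -}

module Defs where

open import Level using (Level; suc; _⊔_)
open import Data.Nat using (ℕ; _∸_)
open import Data.Fin using (Fin)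
open import Data.Maybe using (Maybe; just; nothing)
open import Data.Vec using (Vec; []; _∷_)
open import Data.Product using (Σ; _×_; _,_)
open import Relation.Nullary using (¬_; Dec; yes; no)
open import Relation.Binary.PropositionalEquality using (_≡_; _≢_)
open import Algebra.Structures using (IsCommutativeRing)
open import Function.Bundles using (_↔_)

-- Every finite field has prime-power order, so
-- "q a prime power and F_q the field with q elements" is captured by
-- quantifying over all finite fields of cardinality q.
record FiniteField (q : ℕ) (c : Level) : Set (suc c) where
  infixl 6 _+_ _-_
  infixl 7 _*_
  field
    Carrier  : Set c
    _+_ _*_  : Carrier → Carrier → Carrier
    -_       : Carrier → Carrier
    0# 1#    : Carrier
    isCommutativeRing : IsCommutativeRing _≡_ _+_ _*_ -_ 0# 1#
    0≢1      : 0# ≢ 1#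
    _⁻¹      : Carrier → Carrier            -- value at 0# irrelevant
    inverseʳ : ∀ x → x ≢ 0# → x * (x ⁻¹) ≡ 1#
    _≟_      : (x y : Carrier) → Dec (x ≡ y)
    enumeration : Fin q ↔ Carrier

  _-_ : Carrier → Carrier → Carrier
  x - y = x + (- y)

  _^_ : Carrier → ℕ → Carrier
  x ^ ℕ.zero  = 1#
  x ^ ℕ.suc n = x * (x ^ n)

module _ {q : ℕ} {c : Level} (F : FiniteField q c) where
  open FiniteField F

  -- the projective line P^1(F) = F ∪ {∞}; nothing = ∞
  P1 : Set c
  P1 = Maybe Carrier

  ∞ : P1
  ∞ = nothing

  -- a degree-one rational function (α x + β)/(γ x + δ), αδ - βγ ≠ 0
  record Mobius : Set c where
    constructor mob
    field
      α β γ δ : Carrier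
      nondeg  : α * δ - β * γ ≢ 0#

  -- equality in F(x):  (αx+β)/(γx+δ) = (α'x+β')/(γ'x+δ')  iff
  -- (αx+β)(γ'x+δ') = (α'x+β')(γx+δ) as polynomials (compare coefficients)
  _≈ᴹ_ : Mobius → Mobius → Set c
  mob α β γ δ _ ≈ᴹ mob α' β' γ' δ' _ =
    (α * γ' ≡ α' * γ) × (α * δ' + β * γ' ≡ α' * δ + β' * γ) × (β * δ' ≡ β' * δ)

  actM : Mobius → P1 → P1
  actM (mob α β γ δ _) nothing with γ ≟ 0#
  ... | yes _ = nothing
  ... | no  _ = just (α * (γ ⁻¹))
  actM (mob α β γ δ _) (just x) with (γ * x + δ) ≟ 0#
  ... | yes _ = nothing
  ... | no  _ = just ((α * x + β) * ((γ * x + δ) ⁻¹))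

  powq-2 : P1 → P1
  powq-2 nothing  = nothing
  powq-2 (just x) = just (x ^ (q ∸ 2))

  translate : Carrier → P1 → P1
  translate a nothing  = nothing
  translate a (just x) = just (x - a)

  transp : Carrier → P1 → P1
  transp b nothing = just b
  transp b (just x) with x ≟ b
  ... | yes _ = nothing
  ... | no  _ = just x

  -- for (a_1,...,a_k):  x^{q-2} ∘ (x - a_k) ∘ ... ∘ x^{q-2} ∘ (x - a_1)
  -- (x - a_1 is applied first)
  chainA : ∀ {k} → Vec Carrier k → P1 → P1
  chainA []       p = p
  chainA (a ∷ as) p = chainA as (powq-2 (translate a p))

  -- for (b_1,...,b_k):  (b_1,∞) ∘ (b_2,∞) ∘ ... ∘ (b_k,∞)
  -- ((b_k,∞) is applied first)
  chainC : ∀ {k} → Vec Carrier k → P1 → P1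
  chainC []       p = p
  chainC (b ∷ bs) p = transp b (chainC bs p)

  record RepA (k : ℕ) (σ : P1 → P1) : Set c where
    constructor repA
    field
      μ   : Mobius
      as  : Vec Carrier k
      eqn : ∀ p → σ p ≡ actM μ (chainA as p)

  record RepC (k : ℕ) (σ : P1 → P1) : Set c where
    constructor repC
    field
      ν   : Mobius
      bs  : Vec Carrier k
      eqn : ∀ p → σ p ≡ actM ν (chainC bs p)

  _≈A_ : ∀ {k σ} → RepA k σ → RepA k σ → Set c
  repA μ as _ ≈A repA μ' as' _ = (μ ≈ᴹ μ') × (as ≡ as')

  _≈C_ : ∀ {k σ} → RepC k σ → RepC k σ → Set c
  repC ν bs _ ≈C repC ν' bs' _ = (ν ≈ᴹ ν') × (bs ≡ bs')

  -- two mutually inverse bijections between 𝒜_{σ,k} and 𝒞_{σ,k}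
  -- (maps well defined on the tuples, i.e. respecting equality, and
  -- inverse to each other)
  record MutuallyInverse (k : ℕ) (σ : P1 → P1) : Set c where
    field
      to      : RepA k σ → RepC k σ
      from    : RepC k σ → RepA k σ
      to-cong   : ∀ {x y} → x ≈A y → to x ≈C to y
      from-cong : ∀ {x y} → x ≈C y → from x ≈A from y
      from∘to : ∀ x → from (to x) ≈A x
      to∘from : ∀ y → to (from y) ≈C y

-- Write hₐ = x^{q-2} ∘ (x - a).  By Fermat's little theorem x^{q-2} is inversion on ℙ¹(F), so
-- hₐ = (1/(x - a)) ∘ (a,∞), and a transposition can be moved across hₐ:
-- (y,∞) ∘ hₐ = hₐ ∘ (a + y^{q-2},∞).  Using these repeatedly,
-- h_{a_k} ∘ ⋯ ∘ h_{a_1} = M_a ∘ (b_1,∞) ∘ ⋯ ∘ (b_k,∞), where M_a has degree one, b_1 = a_1, and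
-- (b_2,…,b_k) is the b-tuple of (a_2,…,a_k) moved by y ↦ a_1 + y^{q-2}; this recursion is
-- invertible.  So (μ, a) ↦ (μ ∘ M_a, b) is a bijection, inverted by composing with the adjugate
-- of M_a, which is M_a⁻¹ in F(x).
module Submission where

open import Defs
open import Level using (Level)
open import Data.Nat using (ℕ; _<_; _≤_; s≤s)
open import Function.Definitions using (Bijective)
open import Relation.Binary.PropositionalEquality
  using (_≡_; _≢_; refl; sym; trans; cong; cong₂; module ≡-Reasoning)

open import Algebra.Bundles using (CommutativeRing)
import Algebra.Properties.CommutativeMonoid.Sum as ProductProperties
open import Data.Empty using (⊥-elim)
open import Data.Fin as Fin using (Fin)
open import Data.Fin.Properties using (punchInᵢ≢i)
open import Data.Fin.Permutation using (Permutation)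
open import Data.Integer as ℤ using (ℤ; -[1+_]; _⊖_; _◃_; sign; ∣_∣; 0ℤ; 1ℤ)
import Data.Integer.Properties as ℤ
open import Data.Maybe as Maybe using (Maybe; just; nothing)
import Data.Nat as ℕ
import Data.Nat.Properties as ℕ
open import Data.Product using (_,_)
open import Data.Sign as Sign using (Sign)
open import Data.Vec using (Vec; []; _∷_; map)
open import Data.Vec.Functional using (removeAt)
import Data.Vec.Properties as Vec
open import Function using (_∘_)
open import Function.Bundles using (Inverse; _↔_; mk↔ₛ′)
open import Function.Properties.Inverse using (↔-sym; ↔-trans)
open import Relation.Binary.Consequences using (dec⇒weaklyDec)
open import Relation.Nullary using (yes; no)

-- `solve … refl` compares coefficients by computation, so they are taken in ℤ rather than in the
-- ring itself.
module IntegerCoefficients {c ℓ} (R : CommutativeRing c ℓ) where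
  open CommutativeRing R renaming (refl to ≈-refl; sym to ≈-sym; trans to ≈-trans; reflexive to ≈-reflexive)
  open import Algebra.Properties.Ring ring using (-‿involutive; -0#≈0#; -‿+-comm; -1*x≈-x)
  open import Algebra.Properties.CommutativeSemigroup *-commutativeSemigroup using (interchange)
  open import Algebra.Properties.CommutativeSemigroup +-commutativeSemigroup
    using () renaming (interchange to +-interchange)
  open import Algebra.Properties.Semiring.Mult.TCOptimised semiring using (_×_; 1+×; ×-homo-+; ×1-homo-*)
  open import Algebra.Solver.Ring.AlmostCommutativeRing
  open import Relation.Binary.Reasoning.Setoid setoid

  ⟦_⟧ : ℤ → Carrier
  ⟦ ℤ.+ n ⟧    = n × 1#
  ⟦ -[1+ n ] ⟧ = - (ℕ.suc n × 1#)

  ⟦_⟧ˢ : Sign → Carrier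
  ⟦ Sign.+ ⟧ˢ = 1#
  ⟦ Sign.- ⟧ˢ = - 1#

  ⟦_⟧ˢ-homo : ∀ s t → ⟦ s Sign.* t ⟧ˢ ≈ ⟦ s ⟧ˢ * ⟦ t ⟧ˢ
  ⟦ Sign.+ ⟧ˢ-homo t      = ≈-sym (*-identityˡ _)
  ⟦ Sign.- ⟧ˢ-homo Sign.+ = ≈-sym (*-identityʳ _)
  ⟦ Sign.- ⟧ˢ-homo Sign.- = ≈-sym (≈-trans (-1*x≈-x (- 1#)) (-‿involutive 1#))

  ⟦◃⟧ : ∀ s n → ⟦ s ◃ n ⟧ ≈ ⟦ s ⟧ˢ * (n × 1#)
  ⟦◃⟧ Sign.+ n         = ≈-trans (≈-reflexive (cong ⟦_⟧ (ℤ.+◃n≡+n n))) (≈-sym (*-identityˡ _))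
  ⟦◃⟧ Sign.- ℕ.zero    = ≈-sym (zeroʳ _)
  ⟦◃⟧ Sign.- (ℕ.suc n) = ≈-sym (-1*x≈-x _)

  ⟦⟧-signAbs : ∀ i → ⟦ i ⟧ ≈ ⟦ sign i ⟧ˢ * (∣ i ∣ × 1#)
  ⟦⟧-signAbs i = ≈-trans (≈-reflexive (cong ⟦_⟧ (sym (ℤ.◃-inverse i)))) (⟦◃⟧ (sign i) ∣ i ∣)

  ⟦⟧-homo-* : ∀ i j → ⟦ i ℤ.* j ⟧ ≈ ⟦ i ⟧ * ⟦ j ⟧
  ⟦⟧-homo-* i j = begin
    ⟦ i ℤ.* j ⟧
      ≈⟨ ⟦◃⟧ (sign i Sign.* sign j) (∣ i ∣ ℕ.* ∣ j ∣) ⟩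
    ⟦ sign i Sign.* sign j ⟧ˢ * ((∣ i ∣ ℕ.* ∣ j ∣) × 1#)
      ≈⟨ *-cong (⟦ sign i ⟧ˢ-homo (sign j)) (×1-homo-* ∣ i ∣ ∣ j ∣) ⟩
    (⟦ sign i ⟧ˢ * ⟦ sign j ⟧ˢ) * ((∣ i ∣ × 1#) * (∣ j ∣ × 1#))
      ≈⟨ interchange _ _ _ _ ⟩
    (⟦ sign i ⟧ˢ * (∣ i ∣ × 1#)) * (⟦ sign j ⟧ˢ * (∣ j ∣ × 1#))
      ≈⟨ *-cong (⟦⟧-signAbs i) (⟦⟧-signAbs j) ⟨
    ⟦ i ⟧ * ⟦ j ⟧
      ∎

  [a+x]-[a+y]≈x-y : ∀ a x y → (a + x) - (a + y) ≈ x - y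
  [a+x]-[a+y]≈x-y a x y = begin
    (a + x) - (a + y)       ≈⟨ +-congˡ (-‿+-comm a y) ⟨
    (a + x) + (- a + - y)   ≈⟨ +-interchange a x (- a) (- y) ⟩
    (a - a) + (x - y)       ≈⟨ +-congʳ (-‿inverseʳ a) ⟩
    0# + (x - y)            ≈⟨ +-identityˡ _ ⟩
    x - y                   ∎

  ⟦⊖⟧ : ∀ m n → ⟦ m ⊖ n ⟧ ≈ m × 1# - n × 1#
  ⟦⊖⟧ m         ℕ.zero    = ≈-sym (≈-trans (+-congˡ -0#≈0#) (+-identityʳ _))
  ⟦⊖⟧ ℕ.zero    (ℕ.suc n) = ≈-sym (+-identityˡ _)
  ⟦⊖⟧ (ℕ.suc m) (ℕ.suc n) = begin
    ⟦ ℕ.suc m ⊖ ℕ.suc n ⟧              ≡⟨ cong ⟦_⟧ (ℤ.[1+m]⊖[1+n]≡m⊖n m n) ⟩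
    ⟦ m ⊖ n ⟧                          ≈⟨ ⟦⊖⟧ m n ⟩
    m × 1# - n × 1#                    ≈⟨ [a+x]-[a+y]≈x-y 1# (m × 1#) (n × 1#) ⟨
    (1# + m × 1#) - (1# + n × 1#)      ≈⟨ +-cong (1+× m 1#) (-‿cong (1+× n 1#)) ⟨
    ℕ.suc m × 1# - ℕ.suc n × 1#        ∎

  ⟦⟧-homo-+ : ∀ i j → ⟦ i ℤ.+ j ⟧ ≈ ⟦ i ⟧ + ⟦ j ⟧
  ⟦⟧-homo-+ (ℤ.+ m)  (ℤ.+ n)  = ×-homo-+ 1# m n
  ⟦⟧-homo-+ (ℤ.+ m)  -[1+ n ] = ⟦⊖⟧ m (ℕ.suc n)
  ⟦⟧-homo-+ -[1+ m ] (ℤ.+ n)  = ≈-trans (⟦⊖⟧ n (ℕ.suc m)) (+-comm _ _)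
  ⟦⟧-homo-+ -[1+ m ] -[1+ n ] = begin
    - (ℕ.suc (ℕ.suc (m ℕ.+ n)) × 1#)          ≡⟨ cong (λ k → - (ℕ.suc k × 1#)) (ℕ.+-suc m n) ⟨
    - ((ℕ.suc m ℕ.+ ℕ.suc n) × 1#)            ≈⟨ -‿cong (×-homo-+ 1# (ℕ.suc m) (ℕ.suc n)) ⟩
    - (ℕ.suc m × 1# + ℕ.suc n × 1#)           ≈⟨ -‿+-comm _ _ ⟨
    - (ℕ.suc m × 1#) + - (ℕ.suc n × 1#)       ∎

  ⟦⟧-homo-- : ∀ i → ⟦ ℤ.- i ⟧ ≈ - ⟦ i ⟧
  ⟦⟧-homo-- -[1+ n ]      = ≈-sym (-‿involutive _)
  ⟦⟧-homo-- (ℤ.+ ℕ.zero)  = ≈-sym -0#≈0#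
  ⟦⟧-homo-- (ℤ.+ ℕ.suc n) = ≈-refl

  homomorphism : ℤ.+-*-rawRing -Raw-AlmostCommutative⟶ fromCommutativeRing R
  homomorphism = record
    { ⟦_⟧ = ⟦_⟧ ; +-homo = ⟦⟧-homo-+ ; *-homo = ⟦⟧-homo-* ; -‿homo = ⟦⟧-homo--
    ; 0-homo = ≈-refl ; 1-homo = ≈-refl }

  ⟦⟧-equal? : ∀ i j → Maybe (⟦ i ⟧ ≈ ⟦ j ⟧)
  ⟦⟧-equal? i j = Maybe.map (λ { refl → ≈-refl }) (dec⇒weaklyDec ℤ._≟_ i j)

  open import Algebra.Solver.Ring ℤ.+-*-rawRing (fromCommutativeRing R) homomorphism ⟦⟧-equal? public
    using (solve; _:=_; _:+_; _:*_; _:-_; :-_; con)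

module FieldProperties {q : ℕ} {c : Level} (F : FiniteField q c) where
  open FiniteField F

  commutativeRing : CommutativeRing c c
  commutativeRing = record { isCommutativeRing = isCommutativeRing }

  open CommutativeRing commutativeRing public
    using (+-identityˡ; +-identityʳ; *-identityˡ; *-identityʳ; zeroˡ; zeroʳ;
           *-assoc; *-comm; -‿inverseʳ; *-commutativeMonoid)
  open import Algebra.Properties.Ring (CommutativeRing.ring commutativeRing) public
    using (-0#≈0#)
  open IntegerCoefficients commutativeRing public
    using (solve; _:=_; _:+_; _:*_; _:-_; :-_; con)
  open ≡-Reasoning

  1≢0 : 1# ≢ 0#
  1≢0 = 0≢1 ∘ sym

  ⁻¹-inverseˡ : ∀ {x} → x ≢ 0# → x ⁻¹ * x ≡ 1#
  ⁻¹-inverseˡ {x} x≢0 = trans (*-comm _ _) (inverseʳ x x≢0)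

  x⁻¹*[x*y]≡y : ∀ {x} y → x ≢ 0# → x ⁻¹ * (x * y) ≡ y
  x⁻¹*[x*y]≡y {x} y x≢0 = begin
    x ⁻¹ * (x * y) ≡⟨ *-assoc _ _ _ ⟨
    (x ⁻¹ * x) * y ≡⟨ cong (_* y) (⁻¹-inverseˡ x≢0) ⟩
    1# * y         ≡⟨ *-identityˡ y ⟩
    y              ∎

  x*[x⁻¹*y]≡y : ∀ {x} y → x ≢ 0# → x * (x ⁻¹ * y) ≡ y
  x*[x⁻¹*y]≡y {x} y x≢0 = begin
    x * (x ⁻¹ * y) ≡⟨ *-assoc _ _ _ ⟨
    (x * x ⁻¹) * y ≡⟨ cong (_* y) (inverseʳ x x≢0) ⟩
    1# * y         ≡⟨ *-identityˡ y ⟩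
    y              ∎

  ⁻¹-unique : ∀ {x y} → x ≢ 0# → x * y ≡ 1# → y ≡ x ⁻¹
  ⁻¹-unique {x} {y} x≢0 xy≡1 = begin
    y              ≡⟨ x⁻¹*[x*y]≡y y x≢0 ⟨
    x ⁻¹ * (x * y) ≡⟨ cong (x ⁻¹ *_) xy≡1 ⟩
    x ⁻¹ * 1#      ≡⟨ *-identityʳ _ ⟩
    x ⁻¹           ∎

  x*y≢0 : ∀ {x y} → x ≢ 0# → y ≢ 0# → x * y ≢ 0#
  x*y≢0 {x} {y} x≢0 y≢0 xy≡0 = y≢0 (begin
    y              ≡⟨ x⁻¹*[x*y]≡y y x≢0 ⟨
    x ⁻¹ * (x * y) ≡⟨ cong (x ⁻¹ *_) xy≡0 ⟩
    x ⁻¹ * 0#      ≡⟨ zeroʳ _ ⟩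
    0#             ∎)

  ⁻¹-≢0 : ∀ {x} → x ≢ 0# → x ⁻¹ ≢ 0#
  ⁻¹-≢0 {x} x≢0 x⁻¹≡0 = 0≢1 (begin
    0#         ≡⟨ zeroʳ x ⟨
    x * 0#     ≡⟨ cong (x *_) x⁻¹≡0 ⟨
    x * x ⁻¹   ≡⟨ inverseʳ x x≢0 ⟩
    1#         ∎)

  ⁻¹-involutive : ∀ {x} → x ≢ 0# → x ⁻¹ ⁻¹ ≡ x
  ⁻¹-involutive x≢0 = sym (⁻¹-unique (⁻¹-≢0 x≢0) (⁻¹-inverseˡ x≢0))

  ⁻¹-distrib-* : ∀ {x y} → x ≢ 0# → y ≢ 0# → (x * y) ⁻¹ ≡ x ⁻¹ * y ⁻¹
  ⁻¹-distrib-* {x} {y} x≢0 y≢0 = sym (⁻¹-unique (x*y≢0 x≢0 y≢0) (begin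
    x * y * (x ⁻¹ * y ⁻¹)   ≡⟨ solve 4 (λ x y u v → x :* y :* (u :* v) := x :* u :* (y :* v))
                                       refl x y (x ⁻¹) (y ⁻¹) ⟩
    x * x ⁻¹ * (y * y ⁻¹)   ≡⟨ cong₂ _*_ (inverseʳ x x≢0) (inverseʳ y y≢0) ⟩
    1# * 1#                 ≡⟨ *-identityˡ 1# ⟩
    1#                      ∎))

  [s*u]*[s*v]⁻¹≡u*v⁻¹ : ∀ {s} u {v} → s ≢ 0# → v ≢ 0# → (s * u) * (s * v) ⁻¹ ≡ u * v ⁻¹
  [s*u]*[s*v]⁻¹≡u*v⁻¹ {s} u {v} s≢0 v≢0 = begin
    s * u * (s * v) ⁻¹        ≡⟨ cong (s * u *_) (⁻¹-distrib-* s≢0 v≢0) ⟩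
    s * u * (s ⁻¹ * v ⁻¹)     ≡⟨ solve 4 (λ s u t w → s :* u :* (t :* w) := s :* t :* (u :* w))
                                         refl s u (s ⁻¹) (v ⁻¹) ⟩
    s * s ⁻¹ * (u * v ⁻¹)     ≡⟨ cong (_* (u * v ⁻¹)) (inverseʳ s s≢0) ⟩
    1# * (u * v ⁻¹)           ≡⟨ *-identityˡ _ ⟩
    u * v ⁻¹                  ∎

module LittleFermat {n : ℕ} {c : Level} (F : FiniteField (ℕ.suc n) c) where
  open FiniteField F
  open FieldProperties F
  open ProductProperties *-commutativeMonoid using () renaming
    (sum to product; sum-cong-≗ to product-cong; ∑-distrib-+ to product-distrib-*;
     sum-remove to product-remove; sum-permute to product-permute)
  open ≡-Reasoning

  private
    e : Fin (ℕ.suc n) → Carrier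
    e = Inverse.to enumeration

    e⁻¹ : Carrier → Fin (ℕ.suc n)
    e⁻¹ = Inverse.from enumeration

    e∘e⁻¹ : ∀ y → e (e⁻¹ y) ≡ y
    e∘e⁻¹ = Inverse.strictlyInverseˡ enumeration

    e⁻¹∘e : ∀ i → e⁻¹ (e i) ≡ i
    e⁻¹∘e = Inverse.strictlyInverseʳ enumeration

  ∏ : (Carrier → Carrier) → Carrier
  ∏ f = product (f ∘ e)

  ∏-cong : ∀ {f g} → (∀ y → f y ≡ g y) → ∏ f ≡ ∏ g
  ∏-cong f≗g = product-cong (f≗g ∘ e)

  ∏-distrib-* : ∀ f g → ∏ (λ y → f y * g y) ≡ ∏ f * ∏ g
  ∏-distrib-* f g = product-distrib-* (f ∘ e) (g ∘ e)

  ∏-reindex : ∀ f (h : Carrier ↔ Carrier) → ∏ (f ∘ Inverse.to h) ≡ ∏ f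
  ∏-reindex f h = sym (begin
    product (f ∘ e)                                  ≡⟨ product-permute (f ∘ e) π ⟩
    product (λ i → f (e (e⁻¹ (Inverse.to h (e i))))) ≡⟨ product-cong (λ i → cong f (e∘e⁻¹ (Inverse.to h (e i)))) ⟩
    product (f ∘ Inverse.to h ∘ e)                   ∎)
    where
    π : Permutation (ℕ.suc n) (ℕ.suc n)
    π = ↔-trans enumeration (↔-trans h (↔-sym enumeration))

  product-≢0 : ∀ {m} (u : Fin m → Carrier) → (∀ i → u i ≢ 0#) → product u ≢ 0#
  product-≢0 {ℕ.zero}  u u≢0 = 1≢0
  product-≢0 {ℕ.suc m} u u≢0 = x*y≢0 (u≢0 Fin.zero) (product-≢0 (u ∘ Fin.suc) (u≢0 ∘ Fin.suc))

  product-const : ∀ {m} (u : Fin m → Carrier) {x} → (∀ i → u i ≡ x) → product u ≡ x ^ m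
  product-const {ℕ.zero}  u u≡x = refl
  product-const {ℕ.suc m} u u≡x = cong₂ _*_ (u≡x Fin.zero) (product-const (u ∘ Fin.suc) (u≡x ∘ Fin.suc))

  ifZero_then_else_ : Carrier → Carrier → Carrier → Carrier
  ifZero y then a else b with y ≟ 0#
  ... | yes _ = a
  ... | no  _ = b

  ifZero-0# : ∀ {a b} → ifZero 0# then a else b ≡ a
  ifZero-0# with 0# ≟ 0#
  ... | yes _   = refl
  ... | no  0≢0 = ⊥-elim (0≢0 refl)

  ifZero-≢0 : ∀ {y a b} → y ≢ 0# → ifZero y then a else b ≡ b
  ifZero-≢0 {y} y≢0 with y ≟ 0#
  ... | yes y≡0 = ⊥-elim (y≢0 y≡0)
  ... | no  _   = refl

  ∏-ifZero-const : ∀ x → ∏ (λ y → ifZero y then 1# else x) ≡ x ^ n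
  ∏-ifZero-const x = begin
    product u                      ≡⟨ product-remove {i = i₀} u ⟩
    u i₀ * product (removeAt u i₀) ≡⟨ cong₂ _*_ (trans (cong (ifZero_then 1# else x) (e∘e⁻¹ 0#)) ifZero-0#)
                                                (product-const (removeAt u i₀) (ifZero-≢0 ∘ e-punchIn≢0)) ⟩
    1# * x ^ n                     ≡⟨ *-identityˡ _ ⟩
    x ^ n                          ∎
    where
    u : Fin (ℕ.suc n) → Carrier
    u i = ifZero e i then 1# else x
    i₀ = e⁻¹ 0#
    e-punchIn≢0 : ∀ j → e (Fin.punchIn i₀ j) ≢ 0#
    e-punchIn≢0 j e[j]≡0 = punchInᵢ≢i i₀ j (trans (sym (e⁻¹∘e _)) (cong e⁻¹ e[j]≡0))

  unitPart : Carrier → Carrier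
  unitPart y = ifZero y then 1# else y

  unitPart-≢0 : ∀ y → unitPart y ≢ 0#
  unitPart-≢0 y with y ≟ 0#
  ... | yes _   = 1≢0
  ... | no  y≢0 = y≢0

  unitPart-* : ∀ {x} y → x ≢ 0# → unitPart (x * y) ≡ (ifZero y then 1# else x) * unitPart y
  unitPart-* {x} y x≢0 with y ≟ 0#
  ... | yes refl = begin
    unitPart (x * 0#) ≡⟨ cong unitPart (zeroʳ x) ⟩
    unitPart 0#       ≡⟨ ifZero-0# ⟩
    1#                ≡⟨ *-identityˡ 1# ⟨
    1# * 1#           ∎
  ... | no  y≢0  = ifZero-≢0 (x*y≢0 x≢0 y≢0)

  multiplication : ∀ {x} → x ≢ 0# → Carrier ↔ Carrier
  multiplication {x} x≢0 = mk↔ₛ′ (x *_) (x ⁻¹ *_) (λ y → x*[x⁻¹*y]≡y y x≢0) (λ y → x⁻¹*[x*y]≡y y x≢0)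

  fermat : ∀ {x} → x ≢ 0# → x ^ n ≡ 1#
  fermat {x} x≢0 = begin
    x ^ n              ≡⟨ x⁻¹*[x*y]≡y (x ^ n) P≢0 ⟨
    P ⁻¹ * (P * x ^ n) ≡⟨ cong (P ⁻¹ *_) (trans (*-comm P _) (sym P≡xⁿP)) ⟩
    P ⁻¹ * P           ≡⟨ ⁻¹-inverseˡ P≢0 ⟩
    1#                 ∎
    where
    P = ∏ unitPart
    P≢0 : P ≢ 0#
    P≢0 = product-≢0 (unitPart ∘ e) (unitPart-≢0 ∘ e)
    P≡xⁿP : P ≡ x ^ n * P
    P≡xⁿP = begin
      ∏ unitPart                                       ≡⟨ ∏-reindex unitPart (multiplication x≢0) ⟨
      ∏ (λ y → unitPart (x * y))                       ≡⟨ ∏-cong (λ y → unitPart-* y x≢0) ⟩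
      ∏ (λ y → (ifZero y then 1# else x) * unitPart y) ≡⟨ ∏-distrib-* (ifZero_then 1# else x) unitPart ⟩
      ∏ (λ y → ifZero y then 1# else x) * P            ≡⟨ cong (_* P) (∏-ifZero-const x) ⟩
      x ^ n * P                                        ∎

module MobiusAction {q : ℕ} {c : Level} (F : FiniteField q c) where
  open FiniteField F
  open FieldProperties F
  open ≡-Reasoning

  frac : Carrier → Carrier → P1 F
  frac u v with v ≟ 0#
  ... | yes _ = ∞ F
  ... | no  _ = just (u * v ⁻¹)

  frac-0# : ∀ u {v} → v ≡ 0# → frac u v ≡ ∞ F
  frac-0# u {v} v≡0 with v ≟ 0#
  ... | yes _   = refl
  ... | no  v≢0 = ⊥-elim (v≢0 v≡0)

  frac-≢0 : ∀ u {v} → v ≢ 0# → frac u v ≡ just (u * v ⁻¹)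
  frac-≢0 u {v} v≢0 with v ≟ 0#
  ... | yes v≡0 = ⊥-elim (v≢0 v≡0)
  ... | no  _   = refl

  frac-*ˡ : ∀ {s} u v → s ≢ 0# → frac (s * u) (s * v) ≡ frac u v
  frac-*ˡ {s} u v s≢0 with v ≟ 0#
  ... | yes v≡0 = frac-0# (s * u) (trans (cong (s *_) v≡0) (zeroʳ s))
  ... | no  v≢0 = trans (frac-≢0 (s * u) (x*y≢0 s≢0 v≢0)) (cong just ([s*u]*[s*v]⁻¹≡u*v⁻¹ u s≢0 v≢0))

  actM-just : ∀ μ x → actM F μ (just x) ≡ frac (Mobius.α μ * x + Mobius.β μ) (Mobius.γ μ * x + Mobius.δ μ)
  actM-just (mob α β γ δ nd) x with (γ * x + δ) ≟ 0#
  ... | yes _ = refl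
  ... | no  _ = refl

  actM-∞ : ∀ μ → actM F μ (∞ F) ≡ frac (Mobius.α μ) (Mobius.γ μ)
  actM-∞ (mob α β γ δ nd) with γ ≟ 0#
  ... | yes _ = refl
  ... | no  _ = refl

  actM-frac : ∀ {α β γ δ nd} N D → (D ≡ 0# → N ≢ 0#) →
              frac (α * N + β * D) (γ * N + δ * D) ≡ actM F (mob α β γ δ nd) (frac N D)
  actM-frac {α} {β} {γ} {δ} {nd} N D D≡0⇒N≢0 with D ≟ 0#
  ... | yes refl = begin
    frac (α * N + β * 0#) (γ * N + δ * 0#) ≡⟨ cong₂ frac (a*N+b*0≡N*a α β) (a*N+b*0≡N*a γ δ) ⟩
    frac (N * α) (N * γ)                   ≡⟨ frac-*ˡ α γ (D≡0⇒N≢0 refl) ⟩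
    frac α γ                               ≡⟨ actM-∞ (mob α β γ δ nd) ⟨
    actM F (mob α β γ δ nd) (∞ F)          ∎
    where
    a*N+b*0≡N*a : ∀ a b → a * N + b * 0# ≡ N * a
    a*N+b*0≡N*a a b = solve 3 (λ a b N → a :* N :+ b :* con 0ℤ := N :* a) refl a b N
  ... | no  D≢0 = begin
    frac (α * N + β * D) (γ * N + δ * D)   ≡⟨ cong₂ frac (a*N+b*D≡D*[a*x+b] α β) (a*N+b*D≡D*[a*x+b] γ δ) ⟩
    frac (D * (α * x + β)) (D * (γ * x + δ)) ≡⟨ frac-*ˡ (α * x + β) (γ * x + δ) D≢0 ⟩
    frac (α * x + β) (γ * x + δ)           ≡⟨ actM-just (mob α β γ δ nd) x ⟨
    actM F (mob α β γ δ nd) (just x)       ∎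
    where
    x = N * D ⁻¹
    a*N+b*D≡D*[a*x+b] : ∀ a b → a * N + b * D ≡ D * (a * x + b)
    a*N+b*D≡D*[a*x+b] a b = begin
      a * N + b * D                 ≡⟨ cong (_+ b * D) (*-identityʳ (a * N)) ⟨
      a * N * 1# + b * D            ≡⟨ cong (λ t → a * N * t + b * D) (inverseʳ D D≢0) ⟨
      a * N * (D * D ⁻¹) + b * D    ≡⟨ solve 5 (λ a b N D D⁻¹ → a :* N :* (D :* D⁻¹) :+ b :* D
                                                                 := D :* (a :* (N :* D⁻¹) :+ b)) refl a b N D (D ⁻¹) ⟩
      D * (a * x + b)               ∎

  det : Mobius F → Carrier
  det (mob α β γ δ _) = α * δ - β * γ

  det-∘ : ∀ α β γ δ a b c d →
    (α * a + β * c) * (γ * b + δ * d) - (α * b + β * d) * (γ * a + δ * c) ≡ (α * δ - β * γ) * (a * d - b * c)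
  det-∘ = solve 8 (λ α β γ δ a b c d →
    (α :* a :+ β :* c) :* (γ :* b :+ δ :* d) :- (α :* b :+ β :* d) :* (γ :* a :+ δ :* c)
      := (α :* δ :- β :* γ) :* (a :* d :- b :* c)) refl

  infixr 9 _∘ᴹ_
  _∘ᴹ_ : Mobius F → Mobius F → Mobius F
  mob α β γ δ nd₁ ∘ᴹ mob a b c d nd₂ =
    mob (α * a + β * c) (α * b + β * d) (γ * a + δ * c) (γ * b + δ * d)
        (λ det≡0 → x*y≢0 nd₁ nd₂ (trans (sym (det-∘ α β γ δ a b c d)) det≡0))

  column-≢0 : ∀ {a b c d} x → a * d - b * c ≢ 0# → c * x + d ≡ 0# → a * x + b ≢ 0#
  column-≢0 {a} {b} {c} {d} x det≢0 cx+d≡0 ax+b≡0 = det≢0 (begin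
    a * d - b * c                     ≡⟨ solve 5 (λ a b c d x → a :* d :- b :* c
                                                              := a :* (c :* x :+ d) :- c :* (a :* x :+ b)) refl a b c d x ⟩
    a * (c * x + d) - c * (a * x + b) ≡⟨ cong₂ (λ u v → a * u - c * v) cx+d≡0 ax+b≡0 ⟩
    a * 0# - c * 0#                   ≡⟨ solve 2 (λ a c → a :* con 0ℤ :- c :* con 0ℤ := con 0ℤ) refl a c ⟩
    0#                                ∎)

  actM-∘ : ∀ μ ν p → actM F (μ ∘ᴹ ν) p ≡ actM F μ (actM F ν p)
  actM-∘ μ@(mob α β γ δ nd₁) ν@(mob a b c d nd₂) (just x) = begin
    actM F (μ ∘ᴹ ν) (just x)                  ≡⟨ actM-just (μ ∘ᴹ ν) x ⟩
    frac ((α * a + β * c) * x + (α * b + β * d)) ((γ * a + δ * c) * x + (γ * b + δ * d))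
                                              ≡⟨ cong₂ frac (regroup α β) (regroup γ δ) ⟩
    frac (α * (a * x + b) + β * (c * x + d)) (γ * (a * x + b) + δ * (c * x + d))
                                              ≡⟨ actM-frac (a * x + b) (c * x + d) (column-≢0 x nd₂) ⟩
    actM F μ (frac (a * x + b) (c * x + d))   ≡⟨ cong (actM F μ) (actM-just ν x) ⟨
    actM F μ (actM F ν (just x))              ∎
    where
    regroup : ∀ α β → (α * a + β * c) * x + (α * b + β * d) ≡ α * (a * x + b) + β * (c * x + d)
    regroup α β = solve 7 (λ α β a b c d x → (α :* a :+ β :* c) :* x :+ (α :* b :+ β :* d)
                                               := α :* (a :* x :+ b) :+ β :* (c :* x :+ d)) refl α β a b c d x
  actM-∘ μ@(mob α β γ δ nd₁) ν@(mob a b c d nd₂) nothing = begin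
    actM F (μ ∘ᴹ ν) (∞ F)                     ≡⟨ actM-∞ (μ ∘ᴹ ν) ⟩
    frac (α * a + β * c) (γ * a + δ * c)      ≡⟨ actM-frac a c c≡0⇒a≢0 ⟩
    actM F μ (frac a c)                       ≡⟨ cong (actM F μ) (actM-∞ ν) ⟨
    actM F μ (actM F ν (∞ F))                 ∎
    where
    c≡0⇒a≢0 : c ≡ 0# → a ≢ 0#
    c≡0⇒a≢0 refl refl = nd₂ (solve 2 (λ b d → con 0ℤ :* d :- b :* con 0ℤ := con 0ℤ) refl b d)

  actM-scalar : ∀ μ → Mobius.β μ ≡ 0# → Mobius.γ μ ≡ 0# → Mobius.δ μ ≡ Mobius.α μ → Mobius.α μ ≢ 0# →
                ∀ p → actM F μ p ≡ p
  actM-scalar μ@(mob s _ _ _ _) refl refl refl s≢0 nothing  = trans (actM-∞ μ) (frac-0# s refl)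
  actM-scalar μ@(mob s _ _ _ _) refl refl refl s≢0 (just x) = begin
    actM F μ (just x)               ≡⟨ actM-just μ x ⟩
    frac (s * x + 0#) (0# * x + s)  ≡⟨ cong₂ frac (+-identityʳ _) (trans (cong (_+ s) (zeroˡ x)) (+-identityˡ s)) ⟩
    frac (s * x) s                  ≡⟨ frac-≢0 (s * x) s≢0 ⟩
    just (s * x * s ⁻¹)             ≡⟨ cong just (trans (*-comm _ _) (x⁻¹*[x*y]≡y x s≢0)) ⟩
    just x                          ∎

  idᴹ : Mobius F
  idᴹ = mob 1# 0# 0# 1# (λ det≡0 → 1≢0 (trans det≡1 det≡0))
    where
    det≡1 : 1# ≡ 1# * 1# - 0# * 0#
    det≡1 = solve 0 (con 1ℤ := con 1ℤ :* con 1ℤ :- con 0ℤ :* con 0ℤ) refl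

  actM-idᴹ : ∀ p → actM F idᴹ p ≡ p
  actM-idᴹ = actM-scalar idᴹ refl refl refl 1≢0

  adjᴹ : Mobius F → Mobius F
  adjᴹ (mob α β γ δ nd) = mob δ (- β) (- γ) α (nd ∘ trans (det-adj α β γ δ))
    where
    det-adj : ∀ α β γ δ → α * δ - β * γ ≡ δ * α - (- β) * (- γ)
    det-adj = solve 4 (λ α β γ δ → α :* δ :- β :* γ := δ :* α :- (:- β) :* (:- γ)) refl

  actM-adjᴹ : ∀ μ p → actM F (adjᴹ μ) (actM F μ p) ≡ p
  actM-adjᴹ μ@(mob α β γ δ nd) p = begin
    actM F (adjᴹ μ) (actM F μ p) ≡⟨ actM-∘ (adjᴹ μ) μ p ⟨
    actM F (adjᴹ μ ∘ᴹ μ) p       ≡⟨ actM-scalar (adjᴹ μ ∘ᴹ μ) β-entry γ-entry δ-entry (nd ∘ trans α-entry) p ⟩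
    p                            ∎
    where
    β-entry : δ * β + (- β) * δ ≡ 0#
    β-entry = solve 2 (λ β δ → δ :* β :+ (:- β) :* δ := con 0ℤ) refl β δ
    γ-entry : (- γ) * α + α * γ ≡ 0#
    γ-entry = solve 2 (λ α γ → (:- γ) :* α :+ α :* γ := con 0ℤ) refl α γ
    δ-entry : (- γ) * β + α * δ ≡ δ * α + (- β) * γ
    δ-entry = solve 4 (λ α β γ δ → (:- γ) :* β :+ α :* δ := δ :* α :+ (:- β) :* γ) refl α β γ δ
    α-entry : α * δ - β * γ ≡ δ * α + (- β) * γ
    α-entry = solve 4 (λ α β γ δ → α :* δ :- β :* γ := δ :* α :+ (:- β) :* γ) refl α β γ δ

  infix 4 _≈_
  _≈_ : Mobius F → Mobius F → Set c
  _≈_ = _≈ᴹ_ F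

  ≈-scale : ∀ μ ν s → Mobius.α μ ≡ s * Mobius.α ν → Mobius.β μ ≡ s * Mobius.β ν →
            Mobius.γ μ ≡ s * Mobius.γ ν → Mobius.δ μ ≡ s * Mobius.δ ν → μ ≈ ν
  ≈-scale (mob _ _ _ _ _) (mob α β γ δ _) s refl refl refl refl =
    solve 3 (λ s x y → s :* x :* y := x :* (s :* y)) refl s α γ ,
    solve 5 (λ s α β γ δ → s :* α :* δ :+ s :* β :* γ := α :* (s :* δ) :+ β :* (s :* γ)) refl s α β γ δ ,
    solve 3 (λ s x y → s :* x :* y := x :* (s :* y)) refl s β δ

  adjᴹ-cancelʳ : ∀ μ M → (μ ∘ᴹ M) ∘ᴹ adjᴹ M ≈ μ
  adjᴹ-cancelʳ μ@(mob α β γ δ _) M@(mob a b c d _) =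
    ≈-scale ((μ ∘ᴹ M) ∘ᴹ adjᴹ M) μ (det M) (first α β) (second α β) (first γ δ) (second γ δ)
    where
    first : ∀ x y → (x * a + y * c) * d + (x * b + y * d) * (- c) ≡ (a * d - b * c) * x
    first = solve 6 (λ a b c d x y → (x :* a :+ y :* c) :* d :+ (x :* b :+ y :* d) :* (:- c)
                                       := (a :* d :- b :* c) :* x) refl a b c d
    second : ∀ x y → (x * a + y * c) * (- b) + (x * b + y * d) * a ≡ (a * d - b * c) * y
    second = solve 6 (λ a b c d x y → (x :* a :+ y :* c) :* (:- b) :+ (x :* b :+ y :* d) :* a
                                        := (a :* d :- b :* c) :* y) refl a b c d

  adjᴹ-cancelˡ : ∀ μ M → (μ ∘ᴹ adjᴹ M) ∘ᴹ M ≈ μ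
  adjᴹ-cancelˡ μ@(mob α β γ δ _) M@(mob a b c d _) =
    ≈-scale ((μ ∘ᴹ adjᴹ M) ∘ᴹ M) μ (det M) (first α β) (second α β) (first γ δ) (second γ δ)
    where
    first : ∀ x y → (x * d + y * (- c)) * a + (x * (- b) + y * a) * c ≡ (a * d - b * c) * x
    first = solve 6 (λ a b c d x y → (x :* d :+ y :* (:- c)) :* a :+ (x :* (:- b) :+ y :* a) :* c
                                       := (a :* d :- b :* c) :* x) refl a b c d
    second : ∀ x y → (x * d + y * (- c)) * b + (x * (- b) + y * a) * d ≡ (a * d - b * c) * y
    second = solve 6 (λ a b c d x y → (x :* d :+ y :* (:- c)) :* b :+ (x :* (:- b) :+ y :* a) :* d
                                        := (a :* d :- b :* c) :* y) refl a b c d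

  -- Composing with M = (ax+b)/(cx+d) substitutes into the cross-multiplied identity defining ≈;
  -- each coefficient of the new identity is a fixed combination of the three old ones.
  ∘ᴹ-congʳ : ∀ {μ μ′} M → μ ≈ μ′ → μ ∘ᴹ M ≈ μ′ ∘ᴹ M
  ∘ᴹ-congʳ {mob α β γ δ _} {mob α′ β′ γ′ δ′ _} (mob a b c d _) (h₁ , h₂ , h₃) =
    through (expand₁ α β γ′ δ′) (expand₁ α′ β′ γ δ) ,
    through (expand₂ α β γ′ δ′) (expand₂ α′ β′ γ δ) ,
    through (expand₃ α β γ′ δ′) (expand₃ α′ β′ γ δ)
    where
    through : ∀ {L R u v w} → L ≡ u * (α * γ′) + v * (α * δ′ + β * γ′) + w * (β * δ′) →
              R ≡ u * (α′ * γ) + v * (α′ * δ + β′ * γ) + w * (β′ * δ) → L ≡ R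
    through {u = u} {v} {w} L≡ R≡ =
      trans L≡ (trans (cong₂ _+_ (cong₂ _+_ (cong (u *_) h₁) (cong (v *_) h₂)) (cong (w *_) h₃)) (sym R≡))
    expand₁ : ∀ x y z t → (x * a + y * c) * (z * a + t * c) ≡
              (a * a) * (x * z) + (a * c) * (x * t + y * z) + (c * c) * (y * t)
    expand₁ = solve 8 (λ a b c d x y z t → (x :* a :+ y :* c) :* (z :* a :+ t :* c)
                := (a :* a) :* (x :* z) :+ (a :* c) :* (x :* t :+ y :* z) :+ (c :* c) :* (y :* t)) refl a b c d
    expand₂ : ∀ x y z t → (x * a + y * c) * (z * b + t * d) + (x * b + y * d) * (z * a + t * c) ≡
              (a * b + a * b) * (x * z) + (a * d + b * c) * (x * t + y * z) + (c * d + c * d) * (y * t)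
    expand₂ = solve 8 (λ a b c d x y z t →
                (x :* a :+ y :* c) :* (z :* b :+ t :* d) :+ (x :* b :+ y :* d) :* (z :* a :+ t :* c)
                := (a :* b :+ a :* b) :* (x :* z) :+ (a :* d :+ b :* c) :* (x :* t :+ y :* z)
                   :+ (c :* d :+ c :* d) :* (y :* t)) refl a b c d
    expand₃ : ∀ x y z t → (x * b + y * d) * (z * b + t * d) ≡
              (b * b) * (x * z) + (b * d) * (x * t + y * z) + (d * d) * (y * t)
    expand₃ = solve 8 (λ a b c d x y z t → (x :* b :+ y :* d) :* (z :* b :+ t :* d)
                := (b :* b) :* (x :* z) :+ (b :* d) :* (x :* t :+ y :* z) :+ (d :* d) :* (y :* t)) refl a b c d

module Representations {r : ℕ} {c : Level} (F : FiniteField (ℕ.suc (ℕ.suc (ℕ.suc r))) c) where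
  open FiniteField F
  open FieldProperties F
  open MobiusAction F
  open LittleFermat F using (fermat)
  open ≡-Reasoning

  inv : Carrier → Carrier
  inv x = x ^ ℕ.suc r

  inv-0# : inv 0# ≡ 0#
  inv-0# = zeroˡ _

  inv-≢0 : ∀ {x} → x ≢ 0# → inv x ≡ x ⁻¹
  inv-≢0 x≢0 = ⁻¹-unique x≢0 (fermat x≢0)

  inv-involutive : ∀ x → inv (inv x) ≡ x
  inv-involutive x with x ≟ 0#
  ... | yes refl = trans (cong inv inv-0#) inv-0#
  ... | no  x≢0  = begin
    inv (inv x) ≡⟨ inv-≢0 (λ invx≡0 → ⁻¹-≢0 x≢0 (trans (sym (inv-≢0 x≢0)) invx≡0)) ⟩
    inv x ⁻¹    ≡⟨ cong _⁻¹ (inv-≢0 x≢0) ⟩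
    x ⁻¹ ⁻¹     ≡⟨ ⁻¹-involutive x≢0 ⟩
    x           ∎

  unshift : Carrier → Carrier → Carrier
  unshift a y = a + inv y

  inv-[unshift-a] : ∀ a y → inv (unshift a y - a) ≡ y
  inv-[unshift-a] a y = begin
    inv ((a + inv y) - a) ≡⟨ cong inv (solve 2 (λ a z → (a :+ z) :- a := z) refl a (inv y)) ⟩
    inv (inv y)           ≡⟨ inv-involutive y ⟩
    y                     ∎

  unshift-inv-[x-a] : ∀ a x → unshift a (inv (x - a)) ≡ x
  unshift-inv-[x-a] a x = begin
    a + inv (inv (x - a)) ≡⟨ cong (a +_) (inv-involutive (x - a)) ⟩
    a + (x - a)           ≡⟨ solve 2 (λ a x → a :+ (x :- a) := x) refl a x ⟩
    x                     ∎

  transp-≡ : ∀ {b x} → x ≡ b → transp F b (just x) ≡ ∞ F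
  transp-≡ {b} {x} x≡b with x ≟ b
  ... | yes _   = refl
  ... | no  x≢b = ⊥-elim (x≢b x≡b)

  transp-≢ : ∀ {b x} → x ≢ b → transp F b (just x) ≡ just x
  transp-≢ {b} {x} x≢b with x ≟ b
  ... | yes x≡b = ⊥-elim (x≢b x≡b)
  ... | no  _   = refl

  recipᴹ : Carrier → Mobius F
  recipᴹ a = mob 0# 1# 1# (- a) (λ det≡0 → 1≢0 (begin
    1#                       ≡⟨ solve 1 (λ a → con 1ℤ := :- (con 0ℤ :* (:- a) :- con 1ℤ :* con 1ℤ)) refl a ⟩
    - (0# * (- a) - 1# * 1#) ≡⟨ cong -_ det≡0 ⟩
    - 0#                     ≡⟨ -0#≈0# ⟩
    0#                       ∎))

  shiftInvert : Carrier → P1 F → P1 F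
  shiftInvert a = powq-2 F ∘ translate F a

  shiftInvert≡recipᴹ∘transp : ∀ a p → shiftInvert a p ≡ actM F (recipᴹ a) (transp F a p)
  shiftInvert≡recipᴹ∘transp a nothing = sym (begin
    actM F (recipᴹ a) (just a)        ≡⟨ actM-just (recipᴹ a) a ⟩
    frac (0# * a + 1#) (1# * a + - a) ≡⟨ frac-0# _ (solve 1 (λ a → con 1ℤ :* a :+ :- a := con 0ℤ) refl a) ⟩
    ∞ F                               ∎)
  shiftInvert≡recipᴹ∘transp a (just x) with x ≟ a
  ... | yes refl = sym (begin
    actM F (recipᴹ x) (∞ F)    ≡⟨ actM-∞ (recipᴹ x) ⟩
    frac 0# 1#                 ≡⟨ frac-≢0 0# 1≢0 ⟩
    just (0# * 1# ⁻¹)          ≡⟨ cong just (zeroˡ _) ⟩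
    just 0#                    ≡⟨ cong just inv-0# ⟨
    just (inv 0#)              ≡⟨ cong (just ∘ inv) (-‿inverseʳ x) ⟨
    just (inv (x - x))         ∎)
  ... | no  x≢a  = sym (begin
    actM F (recipᴹ a) (just x)        ≡⟨ actM-just (recipᴹ a) x ⟩
    frac (0# * x + 1#) (1# * x + - a) ≡⟨ cong₂ frac (solve 1 (λ x → con 0ℤ :* x :+ con 1ℤ := con 1ℤ) refl x)
                                                   (solve 2 (λ x a → con 1ℤ :* x :+ :- a := x :- a) refl x a) ⟩
    frac 1# (x - a)                   ≡⟨ frac-≢0 1# x-a≢0 ⟩
    just (1# * (x - a) ⁻¹)            ≡⟨ cong just (*-identityˡ _) ⟩
    just ((x - a) ⁻¹)                 ≡⟨ cong just (inv-≢0 x-a≢0) ⟨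
    just (inv (x - a))                ∎)
    where
    x-a≢0 : x - a ≢ 0#
    x-a≢0 x-a≡0 = x≢a (begin
      x            ≡⟨ solve 2 (λ x a → x := (x :- a) :+ a) refl x a ⟩
      (x - a) + a  ≡⟨ cong (_+ a) x-a≡0 ⟩
      0# + a       ≡⟨ +-identityˡ a ⟩
      a            ∎)

  transp∘shiftInvert : ∀ a y p → transp F y (shiftInvert a p) ≡ shiftInvert a (transp F (unshift a y) p)
  transp∘shiftInvert a y nothing = cong just (sym (inv-[unshift-a] a y))
  transp∘shiftInvert a y (just x) with x ≟ unshift a y
  ... | yes x≡ = transp-≡ (trans (cong (λ t → inv (t - a)) x≡) (inv-[unshift-a] a y))
  ... | no  x≢ = transp-≢ (λ inv[x-a]≡y → x≢ (trans (sym (unshift-inv-[x-a] a x)) (cong (unshift a) inv[x-a]≡y)))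

  transpositionsOf : ∀ {k} → Vec Carrier k → Vec Carrier k
  transpositionsOf []       = []
  transpositionsOf (a ∷ as) = a ∷ map (unshift a) (transpositionsOf as)

  -- The length is matched explicitly: the recursive call is on a mapped vector, not a subterm.
  translationsOf : ∀ {k} → Vec Carrier k → Vec Carrier k
  translationsOf {ℕ.zero}  []       = []
  translationsOf {ℕ.suc k} (b ∷ bs) = b ∷ translationsOf {k} (map (λ z → inv (z - b)) bs)

  translationsOf-transpositionsOf : ∀ {k} (as : Vec Carrier k) → translationsOf (transpositionsOf as) ≡ as
  translationsOf-transpositionsOf []       = refl
  translationsOf-transpositionsOf (a ∷ as) = cong (a ∷_) (begin
    translationsOf (map (λ z → inv (z - a)) (map (unshift a) (transpositionsOf as)))
      ≡⟨ cong translationsOf (Vec.map-∘ _ _ (transpositionsOf as)) ⟨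
    translationsOf (map (λ y → inv (unshift a y - a)) (transpositionsOf as))
      ≡⟨ cong translationsOf (trans (Vec.map-cong (inv-[unshift-a] a) _) (Vec.map-id _)) ⟩
    translationsOf (transpositionsOf as)
      ≡⟨ translationsOf-transpositionsOf as ⟩
    as ∎)

  transpositionsOf-translationsOf : ∀ {k} (bs : Vec Carrier k) → transpositionsOf (translationsOf bs) ≡ bs
  transpositionsOf-translationsOf []       = refl
  transpositionsOf-translationsOf (b ∷ bs) = cong (b ∷_) (begin
    map (unshift b) (transpositionsOf (translationsOf (map (λ z → inv (z - b)) bs)))
      ≡⟨ cong (map (unshift b)) (transpositionsOf-translationsOf _) ⟩
    map (unshift b) (map (λ z → inv (z - b)) bs)
      ≡⟨ Vec.map-∘ _ _ bs ⟨
    map (λ z → unshift b (inv (z - b))) bs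
      ≡⟨ trans (Vec.map-cong (unshift-inv-[x-a] b) bs) (Vec.map-id bs) ⟩
    bs ∎)

  chainC∘shiftInvert : ∀ a {k} (bs : Vec Carrier k) p →
    chainC F bs (shiftInvert a p) ≡ shiftInvert a (chainC F (map (unshift a) bs) p)
  chainC∘shiftInvert a []       p = refl
  chainC∘shiftInvert a (b ∷ bs) p = begin
    transp F b (chainC F bs (shiftInvert a p))
      ≡⟨ cong (transp F b) (chainC∘shiftInvert a bs p) ⟩
    transp F b (shiftInvert a (chainC F (map (unshift a) bs) p))
      ≡⟨ transp∘shiftInvert a b (chainC F (map (unshift a) bs) p) ⟩
    shiftInvert a (chainC F (map (unshift a) (b ∷ bs)) p)
      ∎

  mobiusOf : ∀ {k} → Vec Carrier k → Mobius F
  mobiusOf []       = idᴹ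
  mobiusOf (a ∷ as) = mobiusOf as ∘ᴹ recipᴹ a

  chainA≡mobiusOf∘chainC : ∀ {k} (as : Vec Carrier k) p →
    chainA F as p ≡ actM F (mobiusOf as) (chainC F (transpositionsOf as) p)
  chainA≡mobiusOf∘chainC []       p = sym (actM-idᴹ p)
  chainA≡mobiusOf∘chainC (a ∷ as) p = begin
    chainA F as (shiftInvert a p)
      ≡⟨ chainA≡mobiusOf∘chainC as (shiftInvert a p) ⟩
    actM F (mobiusOf as) (chainC F bs (shiftInvert a p))
      ≡⟨ cong (actM F (mobiusOf as)) (chainC∘shiftInvert a bs p) ⟩
    actM F (mobiusOf as) (shiftInvert a (chainC F (map (unshift a) bs) p))
      ≡⟨ cong (actM F (mobiusOf as)) (shiftInvert≡recipᴹ∘transp a (chainC F (map (unshift a) bs) p)) ⟩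
    actM F (mobiusOf as) (actM F (recipᴹ a) (chainC F (transpositionsOf (a ∷ as)) p))
      ≡⟨ actM-∘ (mobiusOf as) (recipᴹ a) (chainC F (transpositionsOf (a ∷ as)) p) ⟨
    actM F (mobiusOf (a ∷ as)) (chainC F (transpositionsOf (a ∷ as)) p) ∎
    where bs = transpositionsOf as

  mutuallyInverse : ∀ k σ → MutuallyInverse F k σ
  mutuallyInverse k σ = record
    { to        = to
    ; from      = from
    ; to-cong   = λ {x y} → to-cong {x} {y}
    ; from-cong = λ {x y} → from-cong {x} {y}
    ; from∘to   = from∘to
    ; to∘from   = to∘from
    }
    where
    to : RepA F k σ → RepC F k σ
    to (repA μ as eqn) = repC (μ ∘ᴹ mobiusOf as) (transpositionsOf as) λ p → begin
      σ p
        ≡⟨ eqn p ⟩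
      actM F μ (chainA F as p)
        ≡⟨ cong (actM F μ) (chainA≡mobiusOf∘chainC as p) ⟩
      actM F μ (actM F (mobiusOf as) (chainC F (transpositionsOf as) p))
        ≡⟨ actM-∘ μ (mobiusOf as) (chainC F (transpositionsOf as) p) ⟨
      actM F (μ ∘ᴹ mobiusOf as) (chainC F (transpositionsOf as) p)
        ∎

    from : RepC F k σ → RepA F k σ
    from (repC ν bs eqn) = repA (ν ∘ᴹ adjᴹ M) as λ p → begin
      σ p
        ≡⟨ eqn p ⟩
      actM F ν (chainC F bs p)
        ≡⟨ cong (λ cs → actM F ν (chainC F cs p)) (transpositionsOf-translationsOf bs) ⟨
      actM F ν (chainC F (transpositionsOf as) p)
        ≡⟨ cong (actM F ν) (actM-adjᴹ M (chainC F (transpositionsOf as) p)) ⟨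
      actM F ν (actM F (adjᴹ M) (actM F M (chainC F (transpositionsOf as) p)))
        ≡⟨ cong (actM F ν ∘ actM F (adjᴹ M)) (chainA≡mobiusOf∘chainC as p) ⟨
      actM F ν (actM F (adjᴹ M) (chainA F as p))
        ≡⟨ actM-∘ ν (adjᴹ M) (chainA F as p) ⟨
      actM F (ν ∘ᴹ adjᴹ M) (chainA F as p)
        ∎
      where
      as = translationsOf bs
      M  = mobiusOf as

    to-cong : ∀ {x y} → _≈A_ F x y → _≈C_ F (to x) (to y)
    to-cong {repA μ as _} {repA μ′ _ _} (μ≈μ′ , refl) = ∘ᴹ-congʳ {μ} {μ′} (mobiusOf as) μ≈μ′ , refl

    from-cong : ∀ {x y} → _≈C_ F x y → _≈A_ F (from x) (from y)
    from-cong {repC ν bs _} {repC ν′ _ _} (ν≈ν′ , refl) =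
      ∘ᴹ-congʳ {ν} {ν′} (adjᴹ (mobiusOf (translationsOf bs))) ν≈ν′ , refl

    from∘to : ∀ x → _≈A_ F (from (to x)) x
    from∘to (repA μ as _) rewrite translationsOf-transpositionsOf as = adjᴹ-cancelʳ μ (mobiusOf as) , refl

    to∘from : ∀ y → _≈C_ F (to (from y)) y
    to∘from (repC ν bs _) = adjᴹ-cancelˡ ν (mobiusOf (translationsOf bs)) , transpositionsOf-translationsOf bs

theorem1p1 : {c : Level} (q : ℕ) → 2 < q → (F : FiniteField q c) →
    (k : ℕ) → 1 ≤ k →
    (σ : P1 F → P1 F) → Bijective _≡_ _≡_ σ →
    MutuallyInverse F k σ
theorem1p1 q (s≤s (s≤s (s≤s _))) F k _ σ _ = Representations.mutuallyInverse F k σ
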